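{- Let $q$ be a prime power with $\gcd(q,6)=1$. Then: (a) $F_1(X):=X-\frac13\mathrm{Tr}_{q^2/q}(X^{2q-1})$ permutes $\mathbb{F}_{q^2}$; (b) for any nonsquare $\nu\in\mathbb{F}_q$, the function $x\mapsto \dfrac{x(x^2-9\nu)}{x^2-\nu}$ permutes $\mathbb{F}_q$; (c) $g(X):=\dfrac{X^3-3X^2+1}{X^3-3X+1}$ permutes the set $\mu_{q+1}$ of $(q+1)$-th roots of unity in $\mathbb{F}_{q^2}^*$.
   Context: $\mathrm{Tr}_{q^2/q}(X)$ denotes the polynomial $X^q+X$. "Permutes" means the induced map on the given set is well-defined and bijective. -}

module Defs where

open import Level using (Level) renaming (suc to lsuc)
open import Data.Unit.Polymorphic using (⊤)
open import Data.Nat as ℕ using (ℕ; zero; suc; _≥_)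
open import Data.Nat.Primality using (Prime)
open import Data.Fin using (Fin)
open import Data.Product using (Σ; ∃; _×_; _,_)
open import Relation.Binary.PropositionalEquality using (_≡_)
open import Relation.Nullary using (¬_; Dec)
open import Function.Bundles using (_↔_)
open import Algebra.Structures using (IsCommutativeRing)

IsPrimePower : ℕ → Set
IsPrimePower q = ∃ λ p → ∃ λ k → Prime p × k ≥ 1 × q ≡ p ℕ.^ k

record Field (c : Level) : Set (lsuc c) where
  infixl 7 _*_
  infixl 6 _+_ _-_
  infix  8 -_
  field
    Carrier : Set c
    _+_ _*_ : Carrier → Carrier → Carrier
    -_      : Carrier → Carrier
    0# 1#   : Carrier
    _⁻¹     : Carrier → Carrier
    isCommutativeRing : IsCommutativeRing _≡_ _+_ _*_ -_ 0# 1#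
    0≢1     : ¬ (0# ≡ 1#)
    inverse : ∀ x → ¬ (x ≡ 0#) → x * (x ⁻¹) ≡ 1#
    _≟_     : (x y : Carrier) → Dec (x ≡ y)

  _-_ : Carrier → Carrier → Carrier
  x - y = x + (- y)

  _^_ : Carrier → ℕ → Carrier
  x ^ zero  = 1#
  x ^ suc n = x * (x ^ n)

  ⟦_⟧ : ℕ → Carrier
  ⟦ zero ⟧  = 0#
  ⟦ suc n ⟧ = 1# + ⟦ n ⟧

HasSize : ∀ {c} → Field c → ℕ → Set c
HasSize K n = Field.Carrier K ↔ Fin n

PermutesOn : ∀ {c} {A : Set c} → (A → Set c) → (A → A) → Set c
PermutesOn {A = A} S f =
  (∀ x → S x → S (f x)) ×
  (∀ x y → S x → S y → f x ≡ f y → x ≡ y) ×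
  (∀ y → S y → ∃ λ x → S x × f x ≡ y)

module _ {c} (K : Field c) where
  open Field K

  Tr : ℕ → Carrier → Carrier
  Tr q x = x ^ q + x

  F₁ : ℕ → Carrier → Carrier
  F₁ q x = x - (⟦ 3 ⟧ ⁻¹) * Tr q (x ^ (2 ℕ.* q ℕ.∸ 1))

  hDen : Carrier → Carrier → Carrier
  hDen ν x = x ^ 2 - ν

  h : Carrier → Carrier → Carrier
  h ν x = x * (x ^ 2 - ⟦ 9 ⟧ * ν) * (hDen ν x ⁻¹)

  gDen : Carrier → Carrier
  gDen x = x ^ 3 - ⟦ 3 ⟧ * x + 1#

  g : Carrier → Carrier
  g x = (x ^ 3 - ⟦ 3 ⟧ * (x ^ 2) + 1#) * (gDen x ⁻¹)

  μ : ℕ → Carrier → Set c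
  μ n x = ¬ (x ≡ 0#) × x ^ n ≡ 1#

  Univ : Carrier → Set c
  Univ _ = ⊤

  IsSquare : Carrier → Set c
  IsSquare ν = ∃ λ y → y * y ≡ ν

{-# OPTIONS --safe #-}
module Submission where

-- In a field with q² elements, σ x = x ^ q is an involutive automorphism (freshman's dream and
-- Fermat), and μ_{q+1} = {x ≠ 0 : x σ(x) = 1}. The numerator N of g is the reciprocal polynomial
-- of its denominator D, so g maps μ_{q+1} to itself; it is injective there because
-- N(x) D(y) - N(y) D(x) = 3 (x - y) (x y - x + 1) (x y - y + 1), and the last two factors vanish
-- on μ_{q+1} only when x = y. For x ≠ 0 put u = x^(q-1) ∈ μ_{q+1}: then 3 F₁(x) u = -x D(u) and
-- g(u) = σ(F₁ x) / F₁ x, so F₁ x determines u and then x. Hence F₁ is injective, so bijective on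
-- the finite field, and every v ≠ -1 in μ_{q+1} is g(u) for an x with F₁ x = 1 + σ v.
-- In (b), h x = h y with x ≠ y would make ν the square of (x y + 3ν) / (x - y).

open import Defs
open import Level using (Level)
open import Function using (_∘_)
open import Function.Bundles using (Inverse)
open import Function.Definitions using (Injective)
open import Relation.Binary.PropositionalEquality
open import Relation.Nullary using (yes; no; ¬_; contradiction)
open import Data.Empty using (⊥)
open import Data.Unit.Polymorphic using (tt)
open import Data.Product using (∃; _×_; _,_; proj₁; proj₂)
open import Data.Sum using (_⊎_; inj₁; inj₂)
open import Data.Maybe using (Maybe; just; nothing)
open import Data.Nat as ℕ using (ℕ; zero; suc)
import Data.Nat.Properties as ℕP
open import Data.Nat.Solver using (module +-*-Solver)
open import Data.Nat.Divisibility using (_∣_; divides; ∣⇒≤; m%n≡0⇒n∣m)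
open import Data.Nat.DivMod using (_%_; _/_; m≡m%n+[m/n]*n; m%n<n)
open import Data.Nat.GCD using (gcd; gcd-greatest)
open import Data.Nat.Primality using (Prime; euclidsLemma)
open import Data.Nat.Combinatorics using (_C_; nCn≡1; nCk+nC[k+1]≡[n+1]C[k+1])
open import Data.Nat.Combinatorics.Specification using (k>n⇒nCk≡0)
open import Data.Integer as ℤ using (ℤ; -[1+_])
import Data.Integer.Properties as ℤP
import Data.Sign.Base as Sign
open import Data.Fin as Fin using (Fin; punchOut)
import Data.Fin.Properties as FinP
open import Data.Fin.Permutation using (Permutation; permutation)
open import Algebra.Bundles using (CommutativeRing; CommutativeMonoid)
open import Algebra.Structures using (IsCommutativeRing)
import Algebra.Solver.Ring.AlmostCommutativeRing as ACR
import Algebra.Properties.CommutativeMonoid.Sum as CommutativeMonoidSum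
import Algebra.Properties.CommutativeSemiring.Binomial as CommutativeSemiringBinomial
import Algebra.Properties.Semiring.Exp as SemiringExp
import Algebra.Properties.Semiring.Mult as SemiringMult
import Algebra.Properties.Semiring.Sum as SemiringSum

-- Coefficients are taken in ℤ, mapped to K by n ↦ ⟦ n ⟧, so that numerals such as ⟦ 3 ⟧ are normalised.
module RingSolver {c : Level} (K : Field c) where
  open Field K
  open IsCommutativeRing isCommutativeRing public
    hiding (sym; trans; refl; reflexive; isEquivalence; setoid; _-_; zero)
  open ≡-Reasoning

  commutativeRing : CommutativeRing c c
  commutativeRing = record { isCommutativeRing = isCommutativeRing }

  open import Algebra.Properties.Ring (CommutativeRing.ring commutativeRing) public
    using (-‿involutive; -0#≈0#; -‿distribˡ-*; -‿distribʳ-*; -‿+-comm)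

  ⟦+⟧ : ∀ m n → ⟦ m ℕ.+ n ⟧ ≡ ⟦ m ⟧ + ⟦ n ⟧
  ⟦+⟧ zero    n = sym (+-identityˡ _)
  ⟦+⟧ (suc m) n = trans (cong (1# +_) (⟦+⟧ m n)) (sym (+-assoc _ _ _))

  ⟦*⟧ : ∀ m n → ⟦ m ℕ.* n ⟧ ≡ ⟦ m ⟧ * ⟦ n ⟧
  ⟦*⟧ zero    n = sym (zeroˡ _)
  ⟦*⟧ (suc m) n = begin
    ⟦ n ℕ.+ m ℕ.* n ⟧           ≡⟨ ⟦+⟧ n (m ℕ.* n) ⟩
    ⟦ n ⟧ + ⟦ m ℕ.* n ⟧         ≡⟨ cong₂ _+_ (sym (*-identityˡ _)) (⟦*⟧ m n) ⟩
    1# * ⟦ n ⟧ + ⟦ m ⟧ * ⟦ n ⟧  ≡⟨ sym (distribʳ _ _ _) ⟩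
    (1# + ⟦ m ⟧) * ⟦ n ⟧        ∎

  fromℤ : ℤ → Carrier
  fromℤ (ℤ.+ n)  = ⟦ n ⟧
  fromℤ -[1+ n ] = - ⟦ suc n ⟧

  fromℤ-⊖ : ∀ m n → fromℤ (m ℤ.⊖ n) ≡ ⟦ m ⟧ - ⟦ n ⟧
  fromℤ-⊖ m zero = begin
    fromℤ (m ℤ.⊖ zero) ≡⟨ cong fromℤ (ℤP.⊖-≥ {m} {0} ℕ.z≤n) ⟩
    ⟦ m ⟧              ≡⟨ sym (+-identityʳ _) ⟩
    ⟦ m ⟧ + 0#         ≡⟨ cong (⟦ m ⟧ +_) (sym -0#≈0#) ⟩
    ⟦ m ⟧ - 0#         ∎
  fromℤ-⊖ zero (suc n) = begin
    fromℤ (zero ℤ.⊖ suc n) ≡⟨ cong fromℤ (ℤP.⊖-< {0} {suc n} (ℕ.s≤s ℕ.z≤n)) ⟩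
    - ⟦ suc n ⟧            ≡⟨ sym (+-identityˡ _) ⟩
    0# - ⟦ suc n ⟧         ∎
  fromℤ-⊖ (suc m) (suc n) = begin
    fromℤ (suc m ℤ.⊖ suc n)          ≡⟨ cong fromℤ (ℤP.[1+m]⊖[1+n]≡m⊖n m n) ⟩
    fromℤ (m ℤ.⊖ n)                  ≡⟨ fromℤ-⊖ m n ⟩
    ⟦ m ⟧ - ⟦ n ⟧                    ≡⟨ cong (_+ - ⟦ n ⟧) (sym (+-identityˡ _)) ⟩
    (0# + ⟦ m ⟧) - ⟦ n ⟧             ≡⟨ cong (λ z → (z + ⟦ m ⟧) - ⟦ n ⟧) (sym (-‿inverseʳ 1#)) ⟩
    ((1# - 1#) + ⟦ m ⟧) - ⟦ n ⟧      ≡⟨ cong (_+ - ⟦ n ⟧) (trans (+-assoc _ _ _) (trans (cong (1# +_) (+-comm _ _)) (sym (+-assoc _ _ _)))) ⟩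
    ((1# + ⟦ m ⟧) - 1#) - ⟦ n ⟧      ≡⟨ +-assoc _ _ _ ⟩
    (1# + ⟦ m ⟧) + (- 1# - ⟦ n ⟧)    ≡⟨ cong ((1# + ⟦ m ⟧) +_) (-‿+-comm 1# ⟦ n ⟧) ⟩
    (1# + ⟦ m ⟧) - (1# + ⟦ n ⟧)      ∎

  fromℤ-neg : ∀ i → fromℤ (ℤ.- i) ≡ - fromℤ i
  fromℤ-neg (ℤ.+ zero)  = sym -0#≈0#
  fromℤ-neg (ℤ.+ suc n) = refl
  fromℤ-neg -[1+ n ]    = sym (-‿involutive _)

  fromℤ-+ : ∀ i j → fromℤ (i ℤ.+ j) ≡ fromℤ i + fromℤ j
  fromℤ-+ -[1+ m ] -[1+ n ] = begin
    - (1# + ⟦ suc m ℕ.+ n ⟧)      ≡⟨ cong (λ z → - (1# + z)) (⟦+⟧ (suc m) n) ⟩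
    - (1# + (⟦ suc m ⟧ + ⟦ n ⟧))  ≡⟨ cong -_ (trans (sym (+-assoc _ _ _)) (trans (cong (_+ ⟦ n ⟧) (+-comm 1# _)) (+-assoc _ _ _))) ⟩
    - (⟦ suc m ⟧ + ⟦ suc n ⟧)     ≡⟨ sym (-‿+-comm _ _) ⟩
    - ⟦ suc m ⟧ + - ⟦ suc n ⟧     ∎
  fromℤ-+ -[1+ m ] (ℤ.+ n)  = trans (fromℤ-⊖ n (suc m)) (+-comm _ _)
  fromℤ-+ (ℤ.+ m) -[1+ n ]  = fromℤ-⊖ m (suc n)
  fromℤ-+ (ℤ.+ m) (ℤ.+ n)   = ⟦+⟧ m n

  fromℤ-* : ∀ i j → fromℤ (i ℤ.* j) ≡ fromℤ i * fromℤ j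
  fromℤ-* (ℤ.+ m) (ℤ.+ n) = trans (cong fromℤ (ℤP.+◃n≡+n (m ℕ.* n))) (⟦*⟧ m n)
  fromℤ-* (ℤ.+ m) -[1+ n ] = begin
    fromℤ (Sign.- ℤ.◃ (m ℕ.* suc n)) ≡⟨ neg◃ (m ℕ.* suc n) ⟩
    - ⟦ m ℕ.* suc n ⟧                ≡⟨ cong -_ (⟦*⟧ m (suc n)) ⟩
    - (⟦ m ⟧ * ⟦ suc n ⟧)            ≡⟨ -‿distribʳ-* _ _ ⟩
    ⟦ m ⟧ * - ⟦ suc n ⟧              ∎
    where neg◃ : ∀ k → fromℤ (Sign.- ℤ.◃ k) ≡ - ⟦ k ⟧
          neg◃ k = trans (cong fromℤ (ℤP.-◃n≡-n k)) (fromℤ-neg (ℤ.+ k))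
  fromℤ-* i@(-[1+ _ ]) j@(ℤ.+ _) = begin
    fromℤ (i ℤ.* j)      ≡⟨ cong fromℤ (ℤP.*-comm i j) ⟩
    fromℤ (j ℤ.* i)      ≡⟨ fromℤ-* j i ⟩
    fromℤ j * fromℤ i    ≡⟨ *-comm _ _ ⟩
    fromℤ i * fromℤ j    ∎
  fromℤ-* -[1+ m ] -[1+ n ] = begin
    fromℤ (ℤ.+ (suc m ℕ.* suc n))    ≡⟨ ⟦*⟧ (suc m) (suc n) ⟩
    ⟦ suc m ⟧ * ⟦ suc n ⟧            ≡⟨ sym (-‿involutive _) ⟩
    - - (⟦ suc m ⟧ * ⟦ suc n ⟧)      ≡⟨ cong -_ (-‿distribˡ-* _ _) ⟩
    - (- ⟦ suc m ⟧ * ⟦ suc n ⟧)      ≡⟨ -‿distribʳ-* _ _ ⟩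
    - ⟦ suc m ⟧ * - ⟦ suc n ⟧        ∎

  ℤ-morphism : ℤ.+-*-rawRing ACR.-Raw-AlmostCommutative⟶ ACR.fromCommutativeRing commutativeRing
  ℤ-morphism = record
    { ⟦_⟧ = fromℤ ; +-homo = fromℤ-+ ; *-homo = fromℤ-* ; -‿homo = fromℤ-neg
    ; 0-homo = refl ; 1-homo = +-identityʳ 1# }

  fromℤ-≟ : ∀ i j → Maybe (fromℤ i ≡ fromℤ j)
  fromℤ-≟ i j with i ℤ.≟ j
  ... | yes refl = just refl
  ... | no _     = nothing

  open import Algebra.Solver.Ring ℤ.+-*-rawRing (ACR.fromCommutativeRing commutativeRing) ℤ-morphism fromℤ-≟ public
    using (Polynomial; solve; _:=_; _:+_; _:*_; _:-_; :-_; _:^_; con)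

  κ : ∀ {n} → ℕ → Polynomial n
  κ k = con (ℤ.+ k)

  -- `κ 1` denotes ⟦ 1 ⟧ = 1# + 0#, which is not definitionally 1#
  :1 : ∀ {n} → Polynomial n
  :1 = κ 0 :^ 0

module FieldArithmetic {c : Level} (K : Field c) where
  open Field K
  open RingSolver K public
  open ≡-Reasoning

  1≢0 : ¬ (1# ≡ 0#)
  1≢0 = 0≢1 ∘ sym

  ⁻¹-inverseˡ : ∀ {x} → ¬ (x ≡ 0#) → x ⁻¹ * x ≡ 1#
  ⁻¹-inverseˡ {x} x≢0 = trans (*-comm _ _) (inverse x x≢0)

  *-cancelˡ : ∀ {a x y} → ¬ (a ≡ 0#) → a * x ≡ a * y → x ≡ y
  *-cancelˡ {a} {x} {y} a≢0 eq = begin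
    x                 ≡⟨ sym (*-identityˡ x) ⟩
    1# * x            ≡⟨ cong (_* x) (sym (⁻¹-inverseˡ a≢0)) ⟩
    (a ⁻¹ * a) * x    ≡⟨ *-assoc _ _ _ ⟩
    a ⁻¹ * (a * x)    ≡⟨ cong (a ⁻¹ *_) eq ⟩
    a ⁻¹ * (a * y)    ≡⟨ sym (*-assoc _ _ _) ⟩
    (a ⁻¹ * a) * y    ≡⟨ cong (_* y) (⁻¹-inverseˡ a≢0) ⟩
    1# * y            ≡⟨ *-identityˡ y ⟩
    y                 ∎

  *-cancelʳ : ∀ {a x y} → ¬ (a ≡ 0#) → x * a ≡ y * a → x ≡ y
  *-cancelʳ {a} {x} {y} a≢0 eq = *-cancelˡ a≢0 (trans (*-comm a x) (trans eq (*-comm y a)))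

  x*y≡0⇒x≡0⊎y≡0 : ∀ {x y} → x * y ≡ 0# → x ≡ 0# ⊎ y ≡ 0#
  x*y≡0⇒x≡0⊎y≡0 {x} {y} xy≡0 with x ≟ 0#
  ... | yes x≡0 = inj₁ x≡0
  ... | no  x≢0 = inj₂ (*-cancelˡ x≢0 (trans xy≡0 (sym (zeroʳ x))))

  x≢0⇒x*y≡0⇒y≡0 : ∀ {x y} → ¬ (x ≡ 0#) → x * y ≡ 0# → y ≡ 0#
  x≢0⇒x*y≡0⇒y≡0 x≢0 xy≡0 = *-cancelˡ x≢0 (trans xy≡0 (sym (zeroʳ _)))

  *-≢0 : ∀ {x y} → ¬ (x ≡ 0#) → ¬ (y ≡ 0#) → ¬ (x * y ≡ 0#)
  *-≢0 x≢0 y≢0 xy≡0 = y≢0 (x≢0⇒x*y≡0⇒y≡0 x≢0 xy≡0)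

  ⁻¹-≢0 : ∀ {x} → ¬ (x ≡ 0#) → ¬ (x ⁻¹ ≡ 0#)
  ⁻¹-≢0 {x} x≢0 x⁻¹≡0 = 1≢0 (trans (sym (inverse x x≢0)) (trans (cong (x *_) x⁻¹≡0) (zeroʳ x)))

  x-y≡0⇒x≡y : ∀ {x y} → x - y ≡ 0# → x ≡ y
  x-y≡0⇒x≡y {x} {y} x-y≡0 = begin
    x              ≡⟨ solve 2 (λ x y → x := (x :- y) :+ y) refl x y ⟩
    (x - y) + y    ≡⟨ cong (_+ y) x-y≡0 ⟩
    0# + y         ≡⟨ +-identityˡ y ⟩
    y              ∎

  x≡y⇒x-y≡0 : ∀ {x y} → x ≡ y → x - y ≡ 0#
  x≡y⇒x-y≡0 {x} refl = -‿inverseʳ x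

  x≡y*z⇒x*z⁻¹≡y : ∀ {x y z} → ¬ (z ≡ 0#) → x ≡ y * z → x * z ⁻¹ ≡ y
  x≡y*z⇒x*z⁻¹≡y {x} {y} {z} z≢0 eq = begin
    x * z ⁻¹          ≡⟨ cong (_* z ⁻¹) eq ⟩
    y * z * z ⁻¹      ≡⟨ *-assoc _ _ _ ⟩
    y * (z * z ⁻¹)    ≡⟨ cong (y *_) (inverse z z≢0) ⟩
    y * 1#            ≡⟨ *-identityʳ y ⟩
    y                 ∎

  x*z⁻¹≡y⇒x≡y*z : ∀ {x y z} → ¬ (z ≡ 0#) → x * z ⁻¹ ≡ y → x ≡ y * z
  x*z⁻¹≡y⇒x≡y*z {x} {y} {z} z≢0 eq = begin
    x                 ≡⟨ sym (*-identityʳ x) ⟩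
    x * 1#            ≡⟨ cong (x *_) (sym (⁻¹-inverseˡ z≢0)) ⟩
    x * (z ⁻¹ * z)    ≡⟨ sym (*-assoc _ _ _) ⟩
    x * z ⁻¹ * z      ≡⟨ cong (_* z) eq ⟩
    y * z             ∎

  cross-multiply : ∀ {a b c d} → ¬ (b ≡ 0#) → ¬ (d ≡ 0#) → a * b ⁻¹ ≡ c * d ⁻¹ → a * d ≡ c * b
  cross-multiply {a} {b} {c} {d} b≢0 d≢0 eq = begin
    a * d                ≡⟨ cong (_* d) (x*z⁻¹≡y⇒x≡y*z b≢0 eq) ⟩
    c * d ⁻¹ * b * d     ≡⟨ solve 4 (λ c d⁻¹ b d → c :* d⁻¹ :* b :* d := c :* b :* (d :* d⁻¹)) refl c (d ⁻¹) b d ⟩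
    c * b * (d * d ⁻¹)   ≡⟨ cong (c * b *_) (inverse d d≢0) ⟩
    c * b * 1#           ≡⟨ *-identityʳ _ ⟩
    c * b                ∎

  ≡0-by-combination₁ : ∀ {a e₁} k₁ → e₁ ≡ 0# → a ≡ e₁ * k₁ → a ≡ 0#
  ≡0-by-combination₁ k₁ e₁≡0 a≡ = trans a≡ (trans (cong (_* k₁) e₁≡0) (zeroˡ k₁))

  ≡0-by-combination₂ : ∀ {a e₁ e₂} k₁ k₂ → e₁ ≡ 0# → e₂ ≡ 0# → a ≡ e₁ * k₁ + e₂ * k₂ → a ≡ 0#
  ≡0-by-combination₂ k₁ k₂ e₁≡0 e₂≡0 a≡ = trans a≡ (trans
    (cong₂ _+_ (≡0-by-combination₁ k₁ e₁≡0 refl) (≡0-by-combination₁ k₂ e₂≡0 refl)) (+-identityˡ 0#))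

  ≡0-by-combination₄ : ∀ {a e₁ e₂ e₃ e₄} k₁ k₂ k₃ k₄ → e₁ ≡ 0# → e₂ ≡ 0# → e₃ ≡ 0# → e₄ ≡ 0# →
                       a ≡ e₁ * k₁ + e₂ * k₂ + (e₃ * k₃ + e₄ * k₄) → a ≡ 0#
  ≡0-by-combination₄ k₁ k₂ k₃ k₄ e₁≡0 e₂≡0 e₃≡0 e₄≡0 a≡ = trans a≡ (trans
    (cong₂ _+_ (≡0-by-combination₂ k₁ k₂ e₁≡0 e₂≡0 refl) (≡0-by-combination₂ k₃ k₄ e₃≡0 e₄≡0 refl)) (+-identityˡ 0#))

  ^-+ : ∀ x m n → x ^ (m ℕ.+ n) ≡ x ^ m * x ^ n
  ^-+ x zero    n = sym (*-identityˡ _)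
  ^-+ x (suc m) n = trans (cong (x *_) (^-+ x m n)) (sym (*-assoc _ _ _))

  *-^ : ∀ x y n → (x * y) ^ n ≡ x ^ n * y ^ n
  *-^ x y zero    = sym (*-identityˡ 1#)
  *-^ x y (suc n) = trans (cong ((x * y) *_) (*-^ x y n))
    (solve 4 (λ x y a b → (x :* y) :* (a :* b) := (x :* a) :* (y :* b)) refl x y (x ^ n) (y ^ n))

  ^-* : ∀ x m n → x ^ (m ℕ.* n) ≡ (x ^ m) ^ n
  ^-* x m zero    = cong (x ^_) (ℕP.*-zeroʳ m)
  ^-* x m (suc n) = begin
    x ^ (m ℕ.* suc n)       ≡⟨ cong (x ^_) (ℕP.*-suc m n) ⟩
    x ^ (m ℕ.+ m ℕ.* n)     ≡⟨ ^-+ x m (m ℕ.* n) ⟩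
    x ^ m * x ^ (m ℕ.* n)   ≡⟨ cong (x ^ m *_) (^-* x m n) ⟩
    x ^ m * (x ^ m) ^ n     ∎

  ^-comm : ∀ x m n → (x ^ m) ^ n ≡ (x ^ n) ^ m
  ^-comm x m n = trans (sym (^-* x m n)) (trans (cong (x ^_) (ℕP.*-comm m n)) (^-* x n m))

  1^n≡1 : ∀ n → 1# ^ n ≡ 1#
  1^n≡1 zero    = refl
  1^n≡1 (suc n) = trans (*-identityˡ _) (1^n≡1 n)

  ^-≢0 : ∀ {x} n → ¬ (x ≡ 0#) → ¬ (x ^ n ≡ 0#)
  ^-≢0 zero    x≢0 = 1≢0
  ^-≢0 (suc n) x≢0 = *-≢0 x≢0 (^-≢0 n x≢0)

  x*x^[2n∸1]≡x^n*x^n : ∀ n x → ¬ (n ≡ 0) → x * x ^ (2 ℕ.* n ℕ.∸ 1) ≡ x ^ n * x ^ n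
  x*x^[2n∸1]≡x^n*x^n zero    x 0≢0 = contradiction refl 0≢0
  x*x^[2n∸1]≡x^n*x^n (suc m) x _   = trans (cong (x ^_) (cong (suc m ℕ.+_) (ℕP.+-identityʳ (suc m)))) (^-+ x (suc m) (suc m))

  0^[2n∸1]≡0 : ∀ n → ¬ (n ≡ 0) → 0# ^ (2 ℕ.* n ℕ.∸ 1) ≡ 0#
  0^[2n∸1]≡0 zero    0≢0 = contradiction refl 0≢0
  0^[2n∸1]≡0 (suc m) _   = trans (cong (0# ^_) (ℕP.+-suc m (m ℕ.+ 0))) (zeroˡ _)

  x^n≡0⇒x≡0 : ∀ {x} n → x ^ n ≡ 0# → x ≡ 0#
  x^n≡0⇒x≡0 {x} n xⁿ≡0 with x ≟ 0#
  ... | yes x≡0 = x≡0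
  ... | no  x≢0 = contradiction xⁿ≡0 (^-≢0 n x≢0)

  ⟦^⟧ : ∀ m n → ⟦ m ℕ.^ n ⟧ ≡ ⟦ m ⟧ ^ n
  ⟦^⟧ m zero    = +-identityʳ 1#
  ⟦^⟧ m (suc n) = trans (⟦*⟧ m (m ℕ.^ n)) (cong (⟦ m ⟧ *_) (⟦^⟧ m n))

  -- Reduce n modulo 3: if ⟦ 3 ⟧ ≡ 0# then ⟦ n ⟧ ≡ ⟦ n % 3 ⟧, which is 1# or 1# + 1#.
  ⟦3⟧≢0 : ∀ n → ⟦ n ⟧ ≡ 0# → ¬ (3 ∣ n) → ¬ (⟦ 3 ⟧ ≡ 0#)
  ⟦3⟧≢0 n ⟦n⟧≡0 3∤n ⟦3⟧≡0 = remainder≢0 (n % 3) refl (m%n<n n 3)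
    where
    ⟦n%3⟧≡0 : ⟦ n % 3 ⟧ ≡ 0#
    ⟦n%3⟧≡0 = begin
      ⟦ n % 3 ⟧                          ≡⟨ sym (+-identityʳ _) ⟩
      ⟦ n % 3 ⟧ + 0#                     ≡⟨ cong (⟦ n % 3 ⟧ +_) (sym (trans (cong (⟦ n / 3 ⟧ *_) ⟦3⟧≡0) (zeroʳ _))) ⟩
      ⟦ n % 3 ⟧ + ⟦ n / 3 ⟧ * ⟦ 3 ⟧      ≡⟨ cong (⟦ n % 3 ⟧ +_) (sym (⟦*⟧ (n / 3) 3)) ⟩
      ⟦ n % 3 ⟧ + ⟦ n / 3 ℕ.* 3 ⟧        ≡⟨ sym (⟦+⟧ (n % 3) _) ⟩
      ⟦ n % 3 ℕ.+ n / 3 ℕ.* 3 ⟧          ≡⟨ cong ⟦_⟧ (sym (m≡m%n+[m/n]*n n 3)) ⟩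
      ⟦ n ⟧                              ≡⟨ ⟦n⟧≡0 ⟩
      0#                                 ∎
    remainder≢0 : ∀ r → r ≡ n % 3 → r ℕ.< 3 → ⊥
    remainder≢0 0 r≡n%3 _ = 3∤n (m%n≡0⇒n∣m n 3 (sym r≡n%3))
    remainder≢0 1 r≡n%3 _ = 1≢0 (trans (sym (+-identityʳ 1#)) (trans (cong ⟦_⟧ r≡n%3) ⟦n%3⟧≡0))
    remainder≢0 2 r≡n%3 _ = 1≢0 (trans (sym (+-identityʳ 1#)) (trans (cong (1# +_) (sym (trans (cong ⟦_⟧ r≡n%3) ⟦n%3⟧≡0))) ⟦3⟧≡0))
    remainder≢0 (suc (suc (suc r))) _ (ℕ.s≤s (ℕ.s≤s (ℕ.s≤s ())))

Fin-injective⇒surjective : ∀ {n} (f : Fin n → Fin n) → Injective _≡_ _≡_ f → ∀ y → ∃ λ x → f x ≡ y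
Fin-injective⇒surjective {suc n} f f-inj y with FinP.any? (λ x → f x FinP.≟ y)
... | yes found = found
... | no missed = contradiction (FinP.injective⇒≤ punched-inj) ℕP.1+n≰n
  where
  y≢f : ∀ x → ¬ (y ≡ f x)
  y≢f x eq = missed (x , sym eq)
  punched : Fin (suc n) → Fin n
  punched x = punchOut (y≢f x)
  punched-inj : Injective _≡_ _≡_ punched
  punched-inj {x} {x′} eq = f-inj (FinP.punchOut-injective (y≢f x) (y≢f x′) eq)

module FiniteField {c : Level} (K : Field c) {N : ℕ} (size : HasSize K N) where
  open Field K
  open FieldArithmetic K
  open Inverse size using (to; from; strictlyInverseˡ; strictlyInverseʳ)
  open ≡-Reasoning

  injective⇒surjective : (f : Carrier → Carrier) → Injective _≡_ _≡_ f → ∀ y → ∃ λ x → f x ≡ y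
  injective⇒surjective f f-inj y =
    let i , eq = Fin-injective⇒surjective (to ∘ f ∘ from) to∘f∘from-inj (to y)
    in from i , trans (sym (strictlyInverseʳ _)) (trans (cong from eq) (strictlyInverseʳ y))
    where
    to∘f∘from-inj : Injective _≡_ _≡_ (to ∘ f ∘ from)
    to∘f∘from-inj {i} {j} eq = begin
      i                  ≡⟨ sym (strictlyInverseˡ i) ⟩
      to (from i)        ≡⟨ cong to (f-inj (trans (sym (strictlyInverseʳ _)) (trans (cong from eq) (strictlyInverseʳ _)))) ⟩
      to (from j)        ≡⟨ strictlyInverseˡ j ⟩
      j                  ∎

  injective⇒permutes : (f : Carrier → Carrier) → Injective _≡_ _≡_ f → PermutesOn (Univ K) f
  injective⇒permutes f f-inj = (λ _ _ → tt) , (λ _ _ _ _ → f-inj) ,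
    λ y _ → let x , fx≡y = injective⇒surjective f f-inj y in x , tt , fx≡y

  module _ (M : CommutativeMonoid c c) where
    open CommutativeMonoid M using (_≈_; reflexive) renaming (Carrier to A; trans to ≈-trans)
    open CommutativeMonoidSum M using (sum; sum-permute; sum-cong-≗)

    sum-reindex : (h : Carrier → A) {f g : Carrier → Carrier} →
                  (∀ a → f (g a) ≡ a) → (∀ a → g (f a) ≡ a) →
                  sum (h ∘ from) ≈ sum (h ∘ f ∘ from)
    sum-reindex h {f} {g} fg gf = ≈-trans (sum-permute (h ∘ from) π)
                                          (reflexive (sum-cong-≗ (λ i → cong h (strictlyInverseʳ (f (from i))))))
      where
      π : Permutation N N
      π = permutation (to ∘ f ∘ from) (to ∘ g ∘ from)
        (λ i → trans (cong (to ∘ f) (strictlyInverseʳ _)) (trans (cong to (fg _)) (strictlyInverseˡ i)))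
        (λ i → trans (cong (to ∘ g) (strictlyInverseʳ _)) (trans (cong to (gf _)) (strictlyInverseˡ i)))

  module Σ = CommutativeMonoidSum (CommutativeRing.+-commutativeMonoid commutativeRing)
  module Π = CommutativeMonoidSum (CommutativeRing.*-commutativeMonoid commutativeRing)

  Σ-const-1 : ∀ n → Σ.sum {n} (λ _ → 1#) ≡ ⟦ n ⟧
  Σ-const-1 zero    = refl
  Σ-const-1 (suc n) = cong (1# +_) (Σ-const-1 n)

  Π-const : ∀ n x → Π.sum {n} (λ _ → x) ≡ x ^ n
  Π-const zero    x = refl
  Π-const (suc n) x = cong (x *_) (Π-const n x)

  -- Sum all elements, before and after the translation a ↦ a + 1.
  characteristic∣size : ⟦ N ⟧ ≡ 0#
  characteristic∣size = begin
    ⟦ N ⟧                         ≡⟨ sym (Σ-const-1 N) ⟩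
    Σ.sum {N} (λ _ → 1#)          ≡⟨ solve 2 (λ S T → T := (S :+ T) :- S) refl S _ ⟩
    (S + Σ.sum {N} (λ _ → 1#)) - S ≡⟨ cong (_- S) (sym S≡S+N) ⟩
    S - S                         ≡⟨ -‿inverseʳ S ⟩
    0#                            ∎
    where
    S : Carrier
    S = Σ.sum from
    S≡S+N : S ≡ S + Σ.sum {N} (λ _ → 1#)
    S≡S+N = trans (sum-reindex (CommutativeRing.+-commutativeMonoid commutativeRing) (λ a → a) {_+ 1#} {_- 1#}
                    (λ a → solve 1 (λ a → a :+ :- :1 :+ :1 := a) refl a)
                    (λ a → solve 1 (λ a → a :+ :1 :+ :- :1 := a) refl a))
                  (Σ.∑-distrib-+ from (λ _ → 1#))

  replace0by1 : Carrier → Carrier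
  replace0by1 a with a ≟ 0#
  ... | yes _ = 1#
  ... | no  _ = a

  scaleFactor : Carrier → Carrier → Carrier
  scaleFactor x a with a ≟ 0#
  ... | yes _ = 1#
  ... | no  _ = x

  replace0by1≢0 : ∀ a → ¬ (replace0by1 a ≡ 0#)
  replace0by1≢0 a with a ≟ 0#
  ... | yes _   = 1≢0
  ... | no  a≢0 = a≢0

  replace0by1-* : ∀ {x} → ¬ (x ≡ 0#) → ∀ a → replace0by1 (x * a) ≡ scaleFactor x a * replace0by1 a
  replace0by1-* {x} x≢0 a with a ≟ 0# | (x * a) ≟ 0#
  ... | yes _   | yes _    = sym (*-identityˡ 1#)
  ... | yes a≡0 | no  xa≢0 = contradiction (trans (cong (x *_) a≡0) (zeroʳ x)) xa≢0
  ... | no  a≢0 | yes xa≡0 = contradiction xa≡0 (*-≢0 x≢0 a≢0)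
  ... | no  _   | no  _    = refl

  Π-≢0 : ∀ n (f : Fin n → Carrier) → (∀ i → ¬ (f i ≡ 0#)) → ¬ (Π.sum f ≡ 0#)
  Π-≢0 zero    f f≢0 = 1≢0
  Π-≢0 (suc n) f f≢0 = *-≢0 (f≢0 Fin.zero) (Π-≢0 n (f ∘ Fin.suc) (f≢0 ∘ Fin.suc))

  x*Π≡x^n : ∀ x n (f : Fin n → Carrier) j → (∀ i → ¬ (i ≡ j) → f i ≡ x) → f j ≡ 1# → x * Π.sum f ≡ x ^ n
  x*Π≡x^n x (suc n) f Fin.zero f≡x fj≡1 = begin
    x * (f Fin.zero * Π.sum (f ∘ Fin.suc))  ≡⟨ cong (λ z → x * (z * Π.sum (f ∘ Fin.suc))) fj≡1 ⟩
    x * (1# * Π.sum (f ∘ Fin.suc))          ≡⟨ cong (x *_) (*-identityˡ _) ⟩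
    x * Π.sum (f ∘ Fin.suc)                 ≡⟨ cong (x *_) (trans (Π.sum-cong-≗ (λ i → f≡x (Fin.suc i) λ ())) (Π-const n x)) ⟩
    x * x ^ n                               ∎
  x*Π≡x^n x (suc n) f (Fin.suc j) f≡x fj≡1 = begin
    x * (f Fin.zero * Π.sum (f ∘ Fin.suc))  ≡⟨ cong (λ z → x * (z * Π.sum (f ∘ Fin.suc))) (f≡x Fin.zero λ ()) ⟩
    x * (x * Π.sum (f ∘ Fin.suc))           ≡⟨ cong (x *_) (x*Π≡x^n x n (f ∘ Fin.suc) j (λ i i≢j → f≡x (Fin.suc i) (i≢j ∘ FinP.suc-injective)) fj≡1) ⟩
    x * x ^ n                               ∎

  -- Multiplication by x ≠ 0 permutes the nonzero elements, so it fixes their product.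
  fermat : ∀ x → x ^ N ≡ x
  fermat x with x ≟ 0#
  ... | yes x≡0 = 0^N≡0 N (to 0#)
    where
    0^N≡0 : ∀ M → Fin M → x ^ M ≡ x
    0^N≡0 (suc M) _ = trans (cong (_* (x ^ M)) x≡0) (trans (zeroˡ _) (sym x≡0))
  ... | no x≢0 = begin
    x ^ N        ≡⟨ sym (x*Π≡x^n x N (scaleFactor x ∘ from) (to 0#) scale≡x scale≡1) ⟩
    x * S        ≡⟨ cong (x *_) S≡1 ⟩
    x * 1#       ≡⟨ *-identityʳ x ⟩
    x            ∎
    where
    P S : Carrier
    P = Π.sum (replace0by1 ∘ from)
    S = Π.sum (scaleFactor x ∘ from)
    x*[x⁻¹*a]≡a : ∀ a → x * (x ⁻¹ * a) ≡ a
    x*[x⁻¹*a]≡a a = trans (sym (*-assoc _ _ _)) (trans (cong (_* a) (inverse x x≢0)) (*-identityˡ a))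
    x⁻¹*[x*a]≡a : ∀ a → x ⁻¹ * (x * a) ≡ a
    x⁻¹*[x*a]≡a a = trans (sym (*-assoc _ _ _)) (trans (cong (_* a) (⁻¹-inverseˡ x≢0)) (*-identityˡ a))
    P≡S*P : 1# * P ≡ S * P
    P≡S*P = begin
      1# * P                                          ≡⟨ *-identityˡ P ⟩
      P                                               ≡⟨ sum-reindex (CommutativeRing.*-commutativeMonoid commutativeRing) replace0by1
                                                            {x *_} {x ⁻¹ *_} x*[x⁻¹*a]≡a x⁻¹*[x*a]≡a ⟩
      Π.sum (replace0by1 ∘ (x *_) ∘ from)             ≡⟨ Π.sum-cong-≗ (replace0by1-* x≢0 ∘ from) ⟩
      Π.sum (λ i → scaleFactor x (from i) * replace0by1 (from i)) ≡⟨ Π.∑-distrib-+ (scaleFactor x ∘ from) (replace0by1 ∘ from) ⟩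
      S * P                                           ∎
    S≡1 : S ≡ 1#
    S≡1 = sym (*-cancelʳ (Π-≢0 N _ (replace0by1≢0 ∘ from)) P≡S*P)
    scale≡x : ∀ i → ¬ (i ≡ to 0#) → scaleFactor x (from i) ≡ x
    scale≡x i i≢0 with from i ≟ 0#
    ... | yes from-i≡0 = contradiction (trans (sym (strictlyInverseˡ i)) (cong to from-i≡0)) i≢0
    ... | no  _        = refl
    scale≡1 : scaleFactor x (from (to 0#)) ≡ 1#
    scale≡1 rewrite strictlyInverseʳ 0# with 0# ≟ 0#
    ... | yes _   = refl
    ... | no  0≢0 = contradiction refl 0≢0

[1+k]*[1+n]C[1+k]≡[1+n]*nCk : ∀ n k → suc k ℕ.* (suc n C suc k) ≡ suc n ℕ.* (n C k)
[1+k]*[1+n]C[1+k]≡[1+n]*nCk zero zero = refl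
[1+k]*[1+n]C[1+k]≡[1+n]*nCk zero (suc k) = begin
  suc (suc k) ℕ.* (1 C suc (suc k))  ≡⟨ cong (suc (suc k) ℕ.*_) (k>n⇒nCk≡0 {1} {suc (suc k)} (ℕ.s≤s (ℕ.s≤s ℕ.z≤n))) ⟩
  suc (suc k) ℕ.* 0                  ≡⟨ ℕP.*-zeroʳ (suc (suc k)) ⟩
  0                                  ≡⟨ cong (1 ℕ.*_) (sym (k>n⇒nCk≡0 {0} {suc k} (ℕ.s≤s ℕ.z≤n))) ⟩
  1 ℕ.* (0 C suc k)                  ∎
  where open ≡-Reasoning
[1+k]*[1+n]C[1+k]≡[1+n]*nCk (suc m) zero = begin
  1 ℕ.* (suc (suc m) C 1)      ≡⟨ cong (1 ℕ.*_) (sym (nCk+nC[k+1]≡[n+1]C[k+1] (suc m) 0)) ⟩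
  1 ℕ.* (1 ℕ.+ (suc m C 1))    ≡⟨ cong (λ z → 1 ℕ.* (1 ℕ.+ z)) (trans (sym (ℕP.*-identityˡ _)) ([1+k]*[1+n]C[1+k]≡[1+n]*nCk m 0)) ⟩
  1 ℕ.* (1 ℕ.+ suc m ℕ.* 1)    ≡⟨ solve 1 (λ m → con 1 :* (con 1 :+ (con 1 :+ m) :* con 1) := (con 2 :+ m) :* con 1) refl m ⟩
  suc (suc m) ℕ.* 1            ∎
  where open ≡-Reasoning
        open +-*-Solver
[1+k]*[1+n]C[1+k]≡[1+n]*nCk (suc m) (suc j) = begin
  suc (suc j) ℕ.* (suc n C suc (suc j))
    ≡⟨ cong (suc (suc j) ℕ.*_) (sym (nCk+nC[k+1]≡[n+1]C[k+1] n (suc j))) ⟩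
  suc (suc j) ℕ.* (n C suc j ℕ.+ n C suc (suc j))
    ≡⟨ solve 3 (λ j a b → (con 2 :+ j) :* (a :+ b) := (con 1 :+ j) :* a :+ a :+ (con 2 :+ j) :* b)
               refl j (n C suc j) (n C suc (suc j)) ⟩
  suc j ℕ.* (n C suc j) ℕ.+ (n C suc j) ℕ.+ suc (suc j) ℕ.* (n C suc (suc j))
    ≡⟨ cong₂ (λ u v → u ℕ.+ (n C suc j) ℕ.+ v) ([1+k]*[1+n]C[1+k]≡[1+n]*nCk m j) ([1+k]*[1+n]C[1+k]≡[1+n]*nCk m (suc j)) ⟩
  n ℕ.* (m C j) ℕ.+ (n C suc j) ℕ.+ n ℕ.* (m C suc j)
    ≡⟨ solve 4 (λ n a b c → n :* a :+ b :+ n :* c := n :* (a :+ c) :+ b) refl n (m C j) (n C suc j) (m C suc j) ⟩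
  n ℕ.* (m C j ℕ.+ m C suc j) ℕ.+ (n C suc j)
    ≡⟨ cong (λ z → n ℕ.* z ℕ.+ (n C suc j)) (nCk+nC[k+1]≡[n+1]C[k+1] m j) ⟩
  n ℕ.* (n C suc j) ℕ.+ (n C suc j)
    ≡⟨ ℕP.+-comm (n ℕ.* (n C suc j)) _ ⟩
  suc n ℕ.* (n C suc j)
    ∎
  where open ≡-Reasoning
        open +-*-Solver
        n : ℕ
        n = suc m

prime∣pCk : ∀ {p k} → Prime p → 0 ℕ.< k → k ℕ.< p → p ∣ (p C k)
prime∣pCk {suc n} {suc j} p-prime _ k<p
  with euclidsLemma (suc j) (suc n C suc j) p-prime
         (divides (n C j) (trans ([1+k]*[1+n]C[1+k]≡[1+n]*nCk n j) (ℕP.*-comm (suc n) _)))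
... | inj₁ p∣k   = contradiction (∣⇒≤ p∣k) (ℕP.<⇒≱ k<p)
... | inj₂ p∣pCk = p∣pCk

module Frobenius {c : Level} (K : Field c) where
  open Field K
  open FieldArithmetic K
  open ≡-Reasoning
  private
    module Binomial = CommutativeSemiringBinomial (CommutativeRing.commutativeSemiring commutativeRing)
    module Exp = SemiringExp (CommutativeRing.semiring commutativeRing)
    module Mult = SemiringMult (CommutativeRing.semiring commutativeRing)
    module Sum = SemiringSum (CommutativeRing.semiring commutativeRing)

  ^-Exp : ∀ x n → x Exp.^ n ≡ x ^ n
  ^-Exp x zero    = refl
  ^-Exp x (suc n) = cong (x *_) (^-Exp x n)

  ×-Mult : ∀ n x → n Mult.× x ≡ ⟦ n ⟧ * x
  ×-Mult zero    x = sym (zeroˡ x)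
  ×-Mult (suc n) x = begin
    x + n Mult.× x       ≡⟨ cong (x +_) (×-Mult n x) ⟩
    x + ⟦ n ⟧ * x        ≡⟨ solve 2 (λ x n → x :+ n :* x := (:1 :+ n) :* x) refl x ⟦ n ⟧ ⟩
    (1# + ⟦ n ⟧) * x     ∎

  sum-last : ∀ m (f : Fin (suc m) → Carrier) → (∀ i → Fin.toℕ i ℕ.< m → f i ≡ 0#) → Sum.sum f ≡ f (Fin.fromℕ m)
  sum-last zero    f f≡0 = +-identityʳ _
  sum-last (suc m) f f≡0 = trans (cong₂ _+_ (f≡0 Fin.zero (ℕ.s≤s ℕ.z≤n))
                                            (sum-last m (f ∘ Fin.suc) (λ i i<m → f≡0 (Fin.suc i) (ℕ.s≤s i<m))))
                                 (+-identityˡ _)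

  ⟦⟧-∣ : ∀ {p m} → ⟦ p ⟧ ≡ 0# → p ∣ m → ⟦ m ⟧ ≡ 0#
  ⟦⟧-∣ {p} ⟦p⟧≡0 (divides k refl) = trans (⟦*⟧ k p) (trans (cong (⟦ k ⟧ *_) ⟦p⟧≡0) (zeroʳ _))

  -- All middle binomial coefficients are divisible by p.
  freshman's-dream : ∀ {p} → Prime p → ⟦ p ⟧ ≡ 0# → ∀ a b → (a + b) ^ p ≡ a ^ p + b ^ p
  freshman's-dream {p@(suc (suc n))} p-prime ⟦p⟧≡0 a b = begin
    (a + b) ^ p                                        ≡⟨ sym (^-Exp (a + b) p) ⟩
    (a + b) Exp.^ p                                    ≡⟨ Binomial.theorem p a b ⟩
    term Fin.zero + Sum.sum (term ∘ Fin.suc)           ≡⟨ cong (term Fin.zero +_) (sum-last (suc n) (term ∘ Fin.suc) middle≡0) ⟩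
    term Fin.zero + term (Fin.fromℕ p)                 ≡⟨ cong₂ _+_ term₀ (term-last _ (FinP.toℕ-fromℕ p)) ⟩
    b ^ p + a ^ p                                      ≡⟨ +-comm _ _ ⟩
    a ^ p + b ^ p                                      ∎
    where
    term : Fin (suc p) → Carrier
    term = Binomial.binomialTerm a b p
    term₀ : term Fin.zero ≡ b ^ p
    term₀ = trans (×-Mult 1 _) (trans (cong (λ z → ⟦ 1 ⟧ * (1# * z)) (^-Exp b p))
                                      (solve 1 (λ z → κ 1 :* (:1 :* z) := z) refl (b ^ p)))
    term-last : ∀ k → Fin.toℕ k ≡ p → term k ≡ a ^ p
    term-last k toℕ-k≡p rewrite toℕ-k≡p | nCn≡1 p | ℕP.n∸n≡0 p =
      trans (×-Mult 1 _) (trans (cong (λ z → ⟦ 1 ⟧ * (z * 1#)) (^-Exp a p))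
                                (solve 1 (λ z → κ 1 :* (z :* :1) := z) refl (a ^ p)))
    middle≡0 : ∀ i → Fin.toℕ i ℕ.< suc n → term (Fin.suc i) ≡ 0#
    middle≡0 i i<p-1 = begin
      term (Fin.suc i)                  ≡⟨ ×-Mult (p C suc (Fin.toℕ i)) _ ⟩
      ⟦ p C suc (Fin.toℕ i) ⟧ * monomial  ≡⟨ cong (_* monomial) (⟦⟧-∣ ⟦p⟧≡0 (prime∣pCk p-prime (ℕ.s≤s ℕ.z≤n) (ℕ.s≤s i<p-1))) ⟩
      0# * monomial                     ≡⟨ zeroˡ _ ⟩
      0#                                ∎
      where monomial = a Exp.^ suc (Fin.toℕ i) * b Exp.^ (p ℕ.∸ suc (Fin.toℕ i))

  freshman's-dream-^ : ∀ {p} → Prime p → ⟦ p ⟧ ≡ 0# → ∀ k a b → (a + b) ^ (p ℕ.^ k) ≡ a ^ (p ℕ.^ k) + b ^ (p ℕ.^ k)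
  freshman's-dream-^ p-prime ⟦p⟧≡0 zero a b =
    trans (*-identityʳ _) (cong₂ _+_ (sym (*-identityʳ a)) (sym (*-identityʳ b)))
  freshman's-dream-^ {p} p-prime ⟦p⟧≡0 (suc k) a b = begin
    (a + b) ^ (p ℕ.* p ℕ.^ k)                   ≡⟨ ^-* (a + b) p (p ℕ.^ k) ⟩
    ((a + b) ^ p) ^ (p ℕ.^ k)                   ≡⟨ cong (_^ (p ℕ.^ k)) (freshman's-dream p-prime ⟦p⟧≡0 a b) ⟩
    (a ^ p + b ^ p) ^ (p ℕ.^ k)                 ≡⟨ freshman's-dream-^ p-prime ⟦p⟧≡0 k (a ^ p) (b ^ p) ⟩
    (a ^ p) ^ (p ℕ.^ k) + (b ^ p) ^ (p ℕ.^ k)   ≡⟨ sym (cong₂ _+_ (^-* a p (p ℕ.^ k)) (^-* b p (p ℕ.^ k))) ⟩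
    a ^ (p ℕ.* p ℕ.^ k) + b ^ (p ℕ.* p ℕ.^ k)   ∎

module Conjugation {c : Level} (K : Field c) (q : ℕ) where
  open Field K
  open FieldArithmetic K
  open ≡-Reasoning

  σ : Carrier → Carrier
  σ x = x ^ q

  module Involution (σ-+ : ∀ a b → σ (a + b) ≡ σ a + σ b) (σ-involutive : ∀ a → σ (σ a) ≡ a) where
    σ-* : ∀ a b → σ (a * b) ≡ σ a * σ b
    σ-* a b = *-^ a b q

    σ-0 : σ 0# ≡ 0#
    σ-0 = begin
      σ 0#                  ≡⟨ solve 1 (λ a → a := (a :+ a) :- a) refl (σ 0#) ⟩
      (σ 0# + σ 0#) - σ 0#  ≡⟨ cong (_- σ 0#) (sym (σ-+ 0# 0#)) ⟩
      σ (0# + 0#) - σ 0#    ≡⟨ cong (λ z → σ z - σ 0#) (+-identityˡ 0#) ⟩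
      σ 0# - σ 0#           ≡⟨ -‿inverseʳ (σ 0#) ⟩
      0#                    ∎

    σ-1 : σ 1# ≡ 1#
    σ-1 = 1^n≡1 q

    σ-‿ : ∀ a → σ (- a) ≡ - σ a
    σ-‿ a = begin
      σ (- a)                    ≡⟨ solve 2 (λ a b → b := (a :+ b) :- a) refl (σ a) (σ (- a)) ⟩
      (σ a + σ (- a)) - σ a      ≡⟨ cong (_- σ a) (sym (σ-+ a (- a))) ⟩
      σ (a - a) - σ a            ≡⟨ cong (λ z → σ z - σ a) (-‿inverseʳ a) ⟩
      σ 0# - σ a                 ≡⟨ cong (_- σ a) σ-0 ⟩
      0# - σ a                   ≡⟨ +-identityˡ _ ⟩
      - σ a                      ∎

    σ-sub : ∀ a b → σ (a - b) ≡ σ a - σ b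
    σ-sub a b = trans (σ-+ a (- b)) (cong (σ a +_) (σ-‿ b))

    σ-⟦⟧ : ∀ n → σ ⟦ n ⟧ ≡ ⟦ n ⟧
    σ-⟦⟧ zero    = σ-0
    σ-⟦⟧ (suc n) = trans (σ-+ 1# ⟦ n ⟧) (cong₂ _+_ σ-1 (σ-⟦⟧ n))

    σ-^ : ∀ x n → σ (x ^ n) ≡ σ x ^ n
    σ-^ x n = ^-comm x n q

    σ-≢0 : ∀ {a} → ¬ (a ≡ 0#) → ¬ (σ a ≡ 0#)
    σ-≢0 {a} a≢0 σa≡0 = a≢0 (trans (sym (σ-involutive a)) (trans (cong σ σa≡0) σ-0))

    σ-⁻¹ : ∀ {a} → ¬ (a ≡ 0#) → σ (a ⁻¹) ≡ σ a ⁻¹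
    σ-⁻¹ {a} a≢0 = *-cancelʳ (σ-≢0 a≢0) (begin
      σ (a ⁻¹) * σ a   ≡⟨ sym (σ-* (a ⁻¹) a) ⟩
      σ (a ⁻¹ * a)     ≡⟨ cong σ (⁻¹-inverseˡ a≢0) ⟩
      σ 1#             ≡⟨ σ-1 ⟩
      1#               ≡⟨ sym (⁻¹-inverseˡ (σ-≢0 a≢0)) ⟩
      σ a ⁻¹ * σ a     ∎)

    μ[q+1] : Carrier → Set c
    μ[q+1] = μ K (suc q)

    μ-σ : ∀ {x} → μ[q+1] x → μ[q+1] (σ x)
    μ-σ {x} (x≢0 , xσx≡1) = σ-≢0 x≢0 , trans (cong (σ x *_) (σ-involutive x)) (trans (*-comm _ _) xσx≡1)

    gNum : Carrier → Carrier
    gNum x = x ^ 3 - ⟦ 3 ⟧ * (x ^ 2) + 1#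

    σ-gDen : ∀ x → σ (gDen K x) ≡ gDen K (σ x)
    σ-gDen x = begin
      σ (x ^ 3 - ⟦ 3 ⟧ * x + 1#)         ≡⟨ σ-+ _ 1# ⟩
      σ (x ^ 3 - ⟦ 3 ⟧ * x) + σ 1#       ≡⟨ cong₂ _+_ (σ-sub _ _) σ-1 ⟩
      σ (x ^ 3) - σ (⟦ 3 ⟧ * x) + 1#     ≡⟨ cong₂ (λ a b → a - b + 1#) (σ-^ x 3) (trans (σ-* _ _) (cong (_* σ x) (σ-⟦⟧ 3))) ⟩
      σ x ^ 3 - ⟦ 3 ⟧ * σ x + 1#         ∎

    σ-gNum : ∀ x → σ (gNum x) ≡ gNum (σ x)
    σ-gNum x = begin
      σ (x ^ 3 - ⟦ 3 ⟧ * (x ^ 2) + 1#)         ≡⟨ σ-+ _ 1# ⟩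
      σ (x ^ 3 - ⟦ 3 ⟧ * (x ^ 2)) + σ 1#       ≡⟨ cong₂ _+_ (σ-sub _ _) σ-1 ⟩
      σ (x ^ 3) - σ (⟦ 3 ⟧ * (x ^ 2)) + 1#     ≡⟨ cong₂ (λ a b → a - b + 1#) (σ-^ x 3) (trans (σ-* _ _) (cong₂ _*_ (σ-⟦⟧ 3) (σ-^ x 2))) ⟩
      σ x ^ 3 - ⟦ 3 ⟧ * (σ x ^ 2) + 1#         ∎

    gDen-reciprocal : ∀ {x s} → x * s ≡ 1# → x ^ 3 * gDen K s ≡ gNum x
    gDen-reciprocal {x} {s} xs≡1 = x-y≡0⇒x≡y (≡0-by-combination₁ _ (x≡y⇒x-y≡0 xs≡1)
      (solve 2 (λ x s → x :^ 3 :* (s :^ 3 :- κ 3 :* s :+ :1) :- (x :^ 3 :- κ 3 :* x :^ 2 :+ :1)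
                     := (x :* s :- :1) :* ((x :* s) :* (x :* s) :+ x :* s :+ :1 :- κ 3 :* (x :* x))) refl x s))

    gNum-reciprocal : ∀ {x s} → x * s ≡ 1# → x ^ 3 * gNum s ≡ gDen K x
    gNum-reciprocal {x} {s} xs≡1 = x-y≡0⇒x≡y (≡0-by-combination₁ _ (x≡y⇒x-y≡0 xs≡1)
      (solve 2 (λ x s → x :^ 3 :* (s :^ 3 :- κ 3 :* s :^ 2 :+ :1) :- (x :^ 3 :- κ 3 :* x :+ :1)
                     := (x :* s :- :1) :* ((x :* s) :* (x :* s) :+ x :* s :+ :1 :- κ 3 :* x :* (x :* s :+ :1))) refl x s))

    μ-x*y-x+1≡0⇒x≡y : ∀ {x y} → μ[q+1] x → μ[q+1] y → x * y - x + 1# ≡ 0# → x ≡ y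
    μ-x*y-x+1≡0⇒x≡y {x} {y} (_ , xσx≡1) (_ , yσy≡1) xy-x+1≡0 =
      x-y≡0⇒x≡y (≡0-by-combination₄ (x * y) (- 1#) (- (y * σ y - y)) (- 1#)
        σ[xy-x+1]≡0 xy-x+1≡0 (x≡y⇒x-y≡0 xσx≡1) (x≡y⇒x-y≡0 yσy≡1)
        (solve 4 (λ x y a b → x :- y := (a :* b :- a :+ :1) :* (x :* y) :+ (x :* y :- x :+ :1) :* (:- :1)
                                        :+ ((x :* a :- :1) :* (:- (y :* b :- y)) :+ (y :* b :- :1) :* (:- :1))) refl x y (σ x) (σ y)))
      where
      σ[xy-x+1]≡0 : σ x * σ y - σ x + 1# ≡ 0#
      σ[xy-x+1]≡0 = begin
        σ x * σ y - σ x + 1#      ≡⟨ cong₂ (λ a b → a - σ x + b) (sym (σ-* x y)) (sym σ-1) ⟩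
        σ (x * y) - σ x + σ 1#    ≡⟨ cong (_+ σ 1#) (sym (σ-sub _ _)) ⟩
        σ (x * y - x) + σ 1#      ≡⟨ sym (σ-+ _ _) ⟩
        σ (x * y - x + 1#)        ≡⟨ cong σ xy-x+1≡0 ⟩
        σ 0#                      ≡⟨ σ-0 ⟩
        0#                        ∎

    g-cross-factorisation : ∀ x y → gNum x * gDen K y - gNum y * gDen K x ≡
                                    ⟦ 3 ⟧ * (x - y) * (x * y - x + 1#) * (x * y - y + 1#)
    g-cross-factorisation = solve 2 (λ x y →
      (x :^ 3 :- κ 3 :* x :^ 2 :+ :1) :* (y :^ 3 :- κ 3 :* y :+ :1) :- (y :^ 3 :- κ 3 :* y :^ 2 :+ :1) :* (x :^ 3 :- κ 3 :* x :+ :1)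
      := κ 3 :* (x :- y) :* (x :* y :- x :+ :1) :* (x :* y :- y :+ :1)) refl

    q≢0 : ¬ (q ≡ 0)
    q≢0 q≡0 = 1≢0 (subst (λ n → (0# ^ n) ^ n ≡ 0#) q≡0 (σ-involutive 0#))

    F : Carrier → Carrier
    F = F₁ K q

    F-0 : F 0# ≡ 0#
    F-0 = begin
      0# - ⟦ 3 ⟧ ⁻¹ * (σ y + y)     ≡⟨ cong (λ z → 0# - ⟦ 3 ⟧ ⁻¹ * (σ z + z)) y≡0 ⟩
      0# - ⟦ 3 ⟧ ⁻¹ * (σ 0# + 0#)   ≡⟨ cong (λ z → 0# - ⟦ 3 ⟧ ⁻¹ * (z + 0#)) σ-0 ⟩
      0# - ⟦ 3 ⟧ ⁻¹ * (0# + 0#)     ≡⟨ solve 1 (λ i → κ 0 :- i :* (κ 0 :+ κ 0) := κ 0) refl (⟦ 3 ⟧ ⁻¹) ⟩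
      0#                            ∎
      where
      y = 0# ^ (2 ℕ.* q ℕ.∸ 1)
      y≡0 : y ≡ 0#
      y≡0 = 0^[2n∸1]≡0 q q≢0

    module _ (3≢0 : ¬ (⟦ 3 ⟧ ≡ 0#)) where

      -- A root x of gDen in μ[q+1] is also a root of the reciprocal gNum, which forces x = 1.
      gDen≢0 : ∀ {x} → μ[q+1] x → ¬ (gDen K x ≡ 0#)
      gDen≢0 {x} (x≢0 , xσx≡1) gDen≡0 = 1≢0 (≡0-by-combination₂ (x * x + x - ⟦ 2 ⟧) (- 1#) x-1≡0 gDen≡0
        (solve 1 (λ x → :1 := (x :- :1) :* (x :* x :+ x :- κ 2) :+ (x :^ 3 :- κ 3 :* x :+ :1) :* (:- :1)) refl x))
        where
        gNum≡0 : gNum x ≡ 0#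
        gNum≡0 = begin
          gNum x                  ≡⟨ sym (gDen-reciprocal xσx≡1) ⟩
          x ^ 3 * gDen K (σ x)    ≡⟨ cong (x ^ 3 *_) (trans (sym (σ-gDen x)) (trans (cong σ gDen≡0) σ-0)) ⟩
          x ^ 3 * 0#              ≡⟨ zeroʳ _ ⟩
          0#                      ∎
        x-1≡0 : x - 1# ≡ 0#
        x-1≡0 = x≢0⇒x*y≡0⇒y≡0 (*-≢0 3≢0 x≢0) (begin
          ⟦ 3 ⟧ * x * (x - 1#)      ≡⟨ solve 1 (λ x → κ 3 :* x :* (x :- :1) := (x :^ 3 :- κ 3 :* x :+ :1) :- (x :^ 3 :- κ 3 :* x :^ 2 :+ :1)) refl x ⟩
          gDen K x - gNum x         ≡⟨ cong₂ _-_ gDen≡0 gNum≡0 ⟩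
          0# - 0#                   ≡⟨ -‿inverseʳ 0# ⟩
          0#                        ∎)

      g-μ : ∀ {x} → μ[q+1] x → μ[q+1] (g K x)
      g-μ {x} μx@(_ , xs≡1) = g≢0 , g*σg≡1
        where
        s : Carrier
        s = σ x
        D : Carrier → Carrier
        D = gDen K
        Dx≢0 : ¬ (D x ≡ 0#)
        Dx≢0 = gDen≢0 μx
        Ds≢0 : ¬ (D s ≡ 0#)
        Ds≢0 = gDen≢0 (μ-σ μx)
        σg≡ : σ (g K x) ≡ gNum s * D s ⁻¹
        σg≡ = trans (σ-* _ _) (cong₂ _*_ (σ-gNum x) (trans (σ-⁻¹ Dx≢0) (cong _⁻¹ (σ-gDen x))))
        g*σg≡1 : g K x * σ (g K x) ≡ 1#
        g*σg≡1 = begin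
          gNum x * D x ⁻¹ * σ (g K x)
            ≡⟨ cong (gNum x * D x ⁻¹ *_) σg≡ ⟩
          gNum x * D x ⁻¹ * (gNum s * D s ⁻¹)
            ≡⟨ cong₂ (λ a b → a * D x ⁻¹ * (b * D s ⁻¹)) (sym (gDen-reciprocal xs≡1)) (sym (gDen-reciprocal (trans (*-comm s x) xs≡1))) ⟩
          x ^ 3 * D s * D x ⁻¹ * (s ^ 3 * D x * D s ⁻¹)
            ≡⟨ solve 6 (λ x s a b a⁻¹ b⁻¹ → x :^ 3 :* b :* a⁻¹ :* (s :^ 3 :* a :* b⁻¹) := (x :* s) :^ 3 :* (a :* a⁻¹) :* (b :* b⁻¹))
                       refl x s (D x) (D s) (D x ⁻¹) (D s ⁻¹) ⟩
          (x * s) ^ 3 * (D x * D x ⁻¹) * (D s * D s ⁻¹)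
            ≡⟨ cong₂ (λ a b → a ^ 3 * b * (D s * D s ⁻¹)) xs≡1 (inverse _ Dx≢0) ⟩
          1# ^ 3 * 1# * (D s * D s ⁻¹)
            ≡⟨ cong (1# ^ 3 * 1# *_) (inverse _ Ds≢0) ⟩
          1# ^ 3 * 1# * 1#
            ≡⟨ solve 0 (:1 :^ 3 :* :1 :* :1 := :1) refl ⟩
          1#
            ∎
        g≢0 : ¬ (g K x ≡ 0#)
        g≢0 g≡0 = 1≢0 (trans (sym g*σg≡1) (trans (cong (_* σ (g K x)) g≡0) (zeroˡ _)))

      g-injective : ∀ {x y} → μ[q+1] x → μ[q+1] y → g K x ≡ g K y → x ≡ y
      g-injective {x} {y} μx μy gx≡gy = factors≡0⇒x≡y
        (trans (sym (g-cross-factorisation x y)) (x≡y⇒x-y≡0 (cross-multiply (gDen≢0 μx) (gDen≢0 μy) gx≡gy)))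
        where
        factors≡0⇒x≡y : ⟦ 3 ⟧ * (x - y) * (x * y - x + 1#) * (x * y - y + 1#) ≡ 0# → x ≡ y
        factors≡0⇒x≡y factors≡0 with x*y≡0⇒x≡0⊎y≡0 factors≡0
        ... | inj₂ xy-y+1≡0 = sym (μ-x*y-x+1≡0⇒x≡y μy μx (trans (cong (λ z → z - y + 1#) (*-comm y x)) xy-y+1≡0))
        ... | inj₁ h with x*y≡0⇒x≡0⊎y≡0 h
        ...   | inj₂ xy-x+1≡0 = μ-x*y-x+1≡0⇒x≡y μx μy xy-x+1≡0
        ...   | inj₁ h′ with x*y≡0⇒x≡0⊎y≡0 h′
        ...     | inj₁ 3≡0   = contradiction 3≡0 3≢0
        ...     | inj₂ x-y≡0 = x-y≡0⇒x≡y x-y≡0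

      g[-1]≡-1 : g K (- 1#) ≡ - 1#
      g[-1]≡-1 = x≡y*z⇒x*z⁻¹≡y gDen[-1]≢0
        (solve 0 ((:- :1) :^ 3 :- κ 3 :* (:- :1) :^ 2 :+ :1 := (:- :1) :* ((:- :1) :^ 3 :- κ 3 :* (:- :1) :+ :1)) refl)
        where
        gDen[-1]≢0 : ¬ (gDen K (- 1#) ≡ 0#)
        gDen[-1]≢0 gDen≡0 = 3≢0 (trans (solve 0 (κ 3 := (:- :1) :^ 3 :- κ 3 :* (:- :1) :+ :1) refl) gDen≡0)

      module Ratio {x} (x≢0 : ¬ (x ≡ 0#)) where
        u t y w : Carrier
        u = σ x * x ⁻¹
        t = σ u
        y = x ^ (2 ℕ.* q ℕ.∸ 1)
        w = F x

        u*x≡σx : u * x ≡ σ x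
        u*x≡σx = trans (*-assoc _ _ _) (trans (cong (σ x *_) (⁻¹-inverseˡ x≢0)) (*-identityʳ _))

        u*t≡1 : u * t ≡ 1#
        u*t≡1 = begin
          u * t                              ≡⟨ cong (u *_) (trans (σ-* _ _) (cong₂ _*_ (σ-involutive x) (σ-⁻¹ x≢0))) ⟩
          σ x * x ⁻¹ * (x * σ x ⁻¹)          ≡⟨ solve 4 (λ a a⁻¹ b b⁻¹ → a :* b⁻¹ :* (b :* a⁻¹) := (a :* a⁻¹) :* (b :* b⁻¹))
                                                        refl (σ x) (σ x ⁻¹) x (x ⁻¹) ⟩
          (σ x * σ x ⁻¹) * (x * x ⁻¹)        ≡⟨ cong₂ _*_ (inverse _ (σ-≢0 x≢0)) (inverse x x≢0) ⟩
          1# * 1#                            ≡⟨ *-identityˡ 1# ⟩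
          1#                                 ∎

        μu : μ[q+1] u
        μu = *-≢0 (σ-≢0 x≢0) (⁻¹-≢0 x≢0) , u*t≡1

        y≡u*u*x : y ≡ u * u * x
        y≡u*u*x = *-cancelˡ x≢0 (begin
          x * y               ≡⟨ x*x^[2n∸1]≡x^n*x^n q x q≢0 ⟩
          σ x * σ x           ≡⟨ cong₂ _*_ (sym u*x≡σx) (sym u*x≡σx) ⟩
          (u * x) * (u * x)   ≡⟨ solve 2 (λ u x → (u :* x) :* (u :* x) := x :* (u :* u :* x)) refl u x ⟩
          x * (u * u * x)     ∎)

        σy*σx≡x*x : σ y * σ x ≡ x * x
        σy*σx≡x*x = begin
          σ y * σ x            ≡⟨ sym (σ-* y x) ⟩
          σ (y * x)            ≡⟨ cong σ (trans (*-comm y x) (x*x^[2n∸1]≡x^n*x^n q x q≢0)) ⟩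
          σ (σ x * σ x)        ≡⟨ σ-* _ _ ⟩
          σ (σ x) * σ (σ x)    ≡⟨ cong₂ _*_ (σ-involutive x) (σ-involutive x) ⟩
          x * x                ∎

        σy≡t*x : σ y ≡ t * x
        σy≡t*x = *-cancelʳ x≢0 (x-y≡0⇒x≡y (≡0-by-combination₂ (- (σ y * x)) t
          (x≡y⇒x-y≡0 u*t≡1) (x≡y⇒x-y≡0 (trans (cong (σ y *_) u*x≡σx) σy*σx≡x*x))
          (solve 4 (λ σy x u t → σy :* x :- t :* x :* x := (u :* t :- :1) :* (:- (σy :* x)) :+ (σy :* (u :* x) :- x :* x) :* t) refl (σ y) x u t)))

        3wu+xD[u]≡0 : ⟦ 3 ⟧ * w * u + x * gDen K u ≡ 0#
        3wu+xD[u]≡0 = begin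
          ⟦ 3 ⟧ * w * u + x * gDen K u
            ≡⟨ cong (λ z → ⟦ 3 ⟧ * (x - i * z) * u + x * gDen K u) (cong₂ _+_ σy≡t*x y≡u*u*x) ⟩
          ⟦ 3 ⟧ * (x - i * (t * x + u * u * x)) * u + x * gDen K u
            ≡⟨ ≡0-by-combination₂ _ _ (x≡y⇒x-y≡0 (inverse _ 3≢0)) (x≡y⇒x-y≡0 u*t≡1) expansion ⟩
          0#
            ∎
          where
          i : Carrier
          i = ⟦ 3 ⟧ ⁻¹
          expansion : ⟦ 3 ⟧ * (x - i * (t * x + u * u * x)) * u + x * gDen K u ≡
                      (⟦ 3 ⟧ * i - 1#) * (- (t * x * u + u * u * u * x)) + (u * t - 1#) * (- x)
          expansion = solve 4 (λ x u t i →
            κ 3 :* (x :- i :* (t :* x :+ u :* u :* x)) :* u :+ x :* (u :^ 3 :- κ 3 :* u :+ :1)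
            := (κ 3 :* i :- :1) :* (:- (t :* x :* u :+ u :* u :* u :* x)) :+ (u :* t :- :1) :* (:- x)) refl x u t i

        x*D[u]≡-3wu : x * gDen K u ≡ - (⟦ 3 ⟧ * w * u)
        x*D[u]≡-3wu = begin
          x * gDen K u                                           ≡⟨ solve 2 (λ a b → b := (a :+ b) :- a) refl (⟦ 3 ⟧ * w * u) (x * gDen K u) ⟩
          (⟦ 3 ⟧ * w * u + x * gDen K u) - ⟦ 3 ⟧ * w * u         ≡⟨ cong (_- ⟦ 3 ⟧ * w * u) 3wu+xD[u]≡0 ⟩
          0# - ⟦ 3 ⟧ * w * u                                     ≡⟨ +-identityˡ _ ⟩
          - (⟦ 3 ⟧ * w * u)                                      ∎

        w≢0 : ¬ (w ≡ 0#)
        w≢0 w≡0 = *-≢0 x≢0 (gDen≢0 μu) (begin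
          x * gDen K u                ≡⟨ x*D[u]≡-3wu ⟩
          - (⟦ 3 ⟧ * w * u)           ≡⟨ cong (λ z → - (⟦ 3 ⟧ * z * u)) w≡0 ⟩
          - (⟦ 3 ⟧ * 0# * u)          ≡⟨ solve 2 (λ a u → :- (a :* κ 0 :* u) := κ 0) refl ⟦ 3 ⟧ u ⟩
          0#                          ∎)

        3σw*u+xN[u]≡0 : ⟦ 3 ⟧ * σ w * u + x * gNum u ≡ 0#
        3σw*u+xN[u]≡0 = x≢0⇒x*y≡0⇒y≡0 (proj₁ μu) (begin
          u * (⟦ 3 ⟧ * σ w * u + x * gNum u)
            ≡⟨ cong (λ z → u * (⟦ 3 ⟧ * σ w * u + x * z)) (sym (gDen-reciprocal u*t≡1)) ⟩
          u * (⟦ 3 ⟧ * σ w * u + x * (u ^ 3 * gDen K t))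
            ≡⟨ ≡0-by-combination₂ _ _ σ[3wu+xD[u]] (x≡y⇒x-y≡0 u*t≡1) expansion ⟩
          0#
            ∎)
          where
          σ[3wu+xD[u]] : ⟦ 3 ⟧ * σ w * t + (u * x) * gDen K t ≡ 0#
          σ[3wu+xD[u]] = begin
            ⟦ 3 ⟧ * σ w * t + (u * x) * gDen K t           ≡⟨ cong₂ (λ a b → a * t + b * gDen K t) (cong (_* σ w) (sym (σ-⟦⟧ 3))) u*x≡σx ⟩
            σ ⟦ 3 ⟧ * σ w * σ u + σ x * gDen K (σ u)       ≡⟨ cong₂ (λ a b → a * σ u + σ x * b) (sym (σ-* _ _)) (sym (σ-gDen u)) ⟩
            σ (⟦ 3 ⟧ * w) * σ u + σ x * σ (gDen K u)       ≡⟨ cong₂ _+_ (sym (σ-* _ _)) (sym (σ-* _ _)) ⟩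
            σ (⟦ 3 ⟧ * w * u) + σ (x * gDen K u)           ≡⟨ sym (σ-+ _ _) ⟩
            σ (⟦ 3 ⟧ * w * u + x * gDen K u)               ≡⟨ cong σ 3wu+xD[u]≡0 ⟩
            σ 0#                                           ≡⟨ σ-0 ⟩
            0#                                             ∎
          expansion : u * (⟦ 3 ⟧ * σ w * u + x * (u ^ 3 * gDen K t)) ≡
                      (⟦ 3 ⟧ * σ w * t + (u * x) * gDen K t) * u ^ 3 + (u * t - 1#) * (- (⟦ 3 ⟧ * σ w * u * u))
          expansion = solve 5 (λ u t σw x Dt →
            u :* (κ 3 :* σw :* u :+ x :* (u :^ 3 :* Dt))
            := (κ 3 :* σw :* t :+ (u :* x) :* Dt) :* u :^ 3 :+ (u :* t :- :1) :* (:- (κ 3 :* σw :* u :* u))) refl u t (σ w) x (gDen K t)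

        -- Eliminate x between 3wu + x·gDen(u) = 0 and its conjugate 3σ(w)u + x·gNum(u) = 0.
        g[u]≡σw/w : g K u ≡ σ w * w ⁻¹
        g[u]≡σw/w = x≡y*z⇒x*z⁻¹≡y (gDen≢0 μu) (*-cancelʳ w≢0 (begin
          gNum u * w                   ≡⟨ *-comm _ _ ⟩
          w * gNum u                   ≡⟨ sym (x-y≡0⇒x≡y σwD-wN≡0) ⟩
          σ w * gDen K u               ≡⟨ sym (*-identityʳ _) ⟩
          σ w * gDen K u * 1#          ≡⟨ cong (σ w * gDen K u *_) (sym (⁻¹-inverseˡ w≢0)) ⟩
          σ w * gDen K u * (w ⁻¹ * w)  ≡⟨ solve 4 (λ a b c d → a :* b :* (c :* d) := a :* c :* b :* d) refl (σ w) (gDen K u) (w ⁻¹) w ⟩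
          σ w * w ⁻¹ * gDen K u * w    ∎))
          where
          σwD-wN≡0 : σ w * gDen K u - w * gNum u ≡ 0#
          σwD-wN≡0 = x≢0⇒x*y≡0⇒y≡0 (*-≢0 3≢0 (proj₁ μu)) (≡0-by-combination₂ (gDen K u) (- gNum u) 3σw*u+xN[u]≡0 3wu+xD[u]≡0
            (solve 6 (λ u w σw x D N → κ 3 :* u :* (σw :* D :- w :* N)
                       := (κ 3 :* σw :* u :+ x :* N) :* D :+ (κ 3 :* w :* u :+ x :* D) :* (:- N)) refl u w (σ w) x (gDen K u) (gNum u)))

      F≢0 : ∀ {x} → ¬ (x ≡ 0#) → ¬ (F x ≡ 0#)
      F≢0 x≢0 = Ratio.w≢0 x≢0

      F-injective : Injective _≡_ _≡_ F
      F-injective {x} {y} Fx≡Fy with x ≟ 0# | y ≟ 0#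
      ... | yes x≡0 | yes y≡0 = trans x≡0 (sym y≡0)
      ... | yes x≡0 | no  y≢0 = contradiction (trans (sym Fx≡Fy) (trans (cong F x≡0) F-0)) (F≢0 y≢0)
      ... | no  x≢0 | yes y≡0 = contradiction (trans Fx≡Fy (trans (cong F y≡0) F-0)) (F≢0 x≢0)
      ... | no  x≢0 | no  y≢0 = *-cancelʳ (gDen≢0 X.μu) (begin
        x * gDen K X.u            ≡⟨ X.x*D[u]≡-3wu ⟩
        - (⟦ 3 ⟧ * F x * X.u)     ≡⟨ cong₂ (λ a b → - (⟦ 3 ⟧ * a * b)) Fx≡Fy uˣ≡uʸ ⟩
        - (⟦ 3 ⟧ * F y * Y.u)     ≡⟨ sym Y.x*D[u]≡-3wu ⟩
        y * gDen K Y.u            ≡⟨ cong (λ z → y * gDen K z) (sym uˣ≡uʸ) ⟩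
        y * gDen K X.u            ∎)
        where
        module X = Ratio x≢0
        module Y = Ratio y≢0
        uˣ≡uʸ : X.u ≡ Y.u
        uˣ≡uʸ = g-injective X.μu Y.μu (trans X.g[u]≡σw/w (trans (cong (λ z → σ z * z ⁻¹) Fx≡Fy) (sym Y.g[u]≡σw/w)))

      module _ {N : ℕ} (size : HasSize K N) where
        open FiniteField K size using (injective⇒surjective)

        F-surjective : ∀ z → ∃ λ x → F x ≡ z
        F-surjective = injective⇒surjective F F-injective

        g-surjective : ∀ {v} → μ[q+1] v → ∃ λ u → μ[q+1] u × g K u ≡ v
        g-surjective {v} (v≢0 , vσv≡1) with v ≟ (- 1#)
        ... | yes v≡-1 = - 1# , μ[-1] , trans (g[-1]≡-1) (sym v≡-1)
          where
          -1≢0 : ¬ (- 1# ≡ 0#)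
          -1≢0 -1≡0 = 1≢0 (trans (sym (-‿involutive 1#)) (trans (cong -_ -1≡0) -0#≈0#))
          μ[-1] : μ[q+1] (- 1#)
          μ[-1] = -1≢0 , (begin
            - 1# * σ (- 1#)    ≡⟨ cong (- 1# *_) (trans (σ-‿ 1#) (cong -_ σ-1)) ⟩
            - 1# * - 1#        ≡⟨ solve 0 ((:- :1) :* (:- :1) := :1) refl ⟩
            1#                 ∎)
        ... | no  v≢-1 = Ratio.u x≢0 , Ratio.μu x≢0 , (begin
            g K (Ratio.u x≢0)  ≡⟨ Ratio.g[u]≡σw/w x≢0 ⟩
            σ (F x) * F x ⁻¹   ≡⟨ cong (λ z → σ z * z ⁻¹) Fx≡w ⟩
            σ w * w ⁻¹         ≡⟨ x≡y*z⇒x*z⁻¹≡y w≢0 σw≡v*w ⟩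
            v                  ∎)
          where
          w : Carrier
          w = 1# + σ v
          w≢0 : ¬ (w ≡ 0#)
          w≢0 w≡0 = v≢-1 (x-y≡0⇒x≡y (≡0-by-combination₂ v (- 1#) w≡0 (x≡y⇒x-y≡0 vσv≡1)
            (solve 2 (λ v s → v :- (:- :1) := (:1 :+ s) :* v :+ (v :* s :- :1) :* (:- :1)) refl v (σ v))))
          x : Carrier
          x = proj₁ (F-surjective w)
          Fx≡w : F x ≡ w
          Fx≡w = proj₂ (F-surjective w)
          x≢0 : ¬ (x ≡ 0#)
          x≢0 x≡0 = w≢0 (trans (sym Fx≡w) (trans (cong F x≡0) F-0))
          σw≡v*w : σ w ≡ v * w
          σw≡v*w = begin
            σ (1# + σ v)       ≡⟨ σ-+ 1# (σ v) ⟩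
            σ 1# + σ (σ v)     ≡⟨ cong₂ _+_ σ-1 (σ-involutive v) ⟩
            1# + v             ≡⟨ cong (1# +_) (sym (*-identityʳ v)) ⟩
            1# + v * 1#        ≡⟨ cong (λ z → z + v * 1#) (sym vσv≡1) ⟩
            v * σ v + v * 1#   ≡⟨ solve 2 (λ v s → v :* s :+ v :* :1 := v :* (:1 :+ s)) refl v (σ v) ⟩
            v * (1# + σ v)     ∎

module RationalFunctionH {c : Level} (F : Field c) {ν : Field.Carrier F} (ν-nonsquare : ¬ IsSquare F ν) where
  open Field F
  open FieldArithmetic F
  open ≡-Reasoning

  hDen≢0 : ∀ x → ¬ (hDen F ν x ≡ 0#)
  hDen≢0 x x²-ν≡0 = ν-nonsquare (x , trans (solve 1 (λ x → x :* x := x :^ 2) refl x) (x-y≡0⇒x≡y x²-ν≡0))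

  h-injective : Injective _≡_ _≡_ (h F ν)
  h-injective {x} {y} hx≡hy with (x - y) ≟ 0#
  ... | yes x-y≡0 = x-y≡0⇒x≡y x-y≡0
  ... | no  x-y≢0 = contradiction (ν-square (x≢0⇒x*y≡0⇒y≡0 x-y≢0 (trans (sym factorisation) cross))) ν-nonsquare
    where
    m d : Carrier
    m = x * y + ⟦ 3 ⟧ * ν
    d = x - y
    factorisation : x * (x ^ 2 - ⟦ 9 ⟧ * ν) * (y ^ 2 - ν) - y * (y ^ 2 - ⟦ 9 ⟧ * ν) * (x ^ 2 - ν) ≡ d * (m * m - ν * (d * d))
    factorisation = solve 3 (λ x y ν → x :* (x :^ 2 :- κ 9 :* ν) :* (y :^ 2 :- ν) :- y :* (y :^ 2 :- κ 9 :* ν) :* (x :^ 2 :- ν)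
      := (x :- y) :* ((x :* y :+ κ 3 :* ν) :* (x :* y :+ κ 3 :* ν) :- ν :* ((x :- y) :* (x :- y)))) refl x y ν
    cross : x * (x ^ 2 - ⟦ 9 ⟧ * ν) * (y ^ 2 - ν) - y * (y ^ 2 - ⟦ 9 ⟧ * ν) * (x ^ 2 - ν) ≡ 0#
    cross = x≡y⇒x-y≡0 (cross-multiply (hDen≢0 x) (hDen≢0 y) hx≡hy)
    ν-square : m * m - ν * (d * d) ≡ 0# → IsSquare F ν
    ν-square m²-νd²≡0 = m * d ⁻¹ , (begin
      m * d ⁻¹ * (m * d ⁻¹)          ≡⟨ solve 2 (λ m i → m :* i :* (m :* i) := m :* m :* (i :* i)) refl m (d ⁻¹) ⟩
      m * m * (d ⁻¹ * d ⁻¹)          ≡⟨ cong (_* (d ⁻¹ * d ⁻¹)) (x-y≡0⇒x≡y m²-νd²≡0) ⟩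
      ν * (d * d) * (d ⁻¹ * d ⁻¹)    ≡⟨ solve 3 (λ ν d i → ν :* (d :* d) :* (i :* i) := ν :* ((d :* i) :* (d :* i))) refl ν d (d ⁻¹) ⟩
      ν * ((d * d ⁻¹) * (d * d ⁻¹))  ≡⟨ cong (λ z → ν * (z * z)) (inverse d x-y≢0) ⟩
      ν * (1# * 1#)                  ≡⟨ solve 1 (λ ν → ν :* (:1 :* :1) := ν) refl ν ⟩
      ν                              ∎)

gcd[n,6]≡1⇒3∤n : ∀ {n} → gcd n 6 ≡ 1 → ¬ (3 ∣ n)
gcd[n,6]≡1⇒3∤n gcd≡1 3∣n with ∣⇒≤ (subst (3 ∣_) gcd≡1 (gcd-greatest 3∣n (divides 2 refl)))
... | ℕ.s≤s ()

module SquareOrderField {c : Level} (K : Field c) {q p k : ℕ}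
  (p-prime : Prime p) (q≡p^k : q ≡ p ℕ.^ k) (size : HasSize K (q ℕ.* q)) where
  open Field K
  open FieldArithmetic K
  open FiniteField K size using (characteristic∣size; fermat)
  open Frobenius K using (freshman's-dream-^)

  ⟦q⟧≡0 : ⟦ q ⟧ ≡ 0#
  ⟦q⟧≡0 with x*y≡0⇒x≡0⊎y≡0 (trans (sym (⟦*⟧ q q)) characteristic∣size)
  ... | inj₁ ⟦q⟧≡0 = ⟦q⟧≡0
  ... | inj₂ ⟦q⟧≡0 = ⟦q⟧≡0

  ⟦p⟧≡0 : ⟦ p ⟧ ≡ 0#
  ⟦p⟧≡0 = x^n≡0⇒x≡0 k (trans (sym (⟦^⟧ p k)) (trans (cong ⟦_⟧ (sym q≡p^k)) ⟦q⟧≡0))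

  σ-+ : ∀ a b → (a + b) ^ q ≡ a ^ q + b ^ q
  σ-+ = subst (λ n → ∀ a b → (a + b) ^ n ≡ a ^ n + b ^ n) (sym q≡p^k) (freshman's-dream-^ p-prime ⟦p⟧≡0 k)

  σ-involutive : ∀ a → (a ^ q) ^ q ≡ a
  σ-involutive a = trans (sym (^-* a q q)) (fermat a)

theorem3p1 : ∀ {c : Level} (q : ℕ) → IsPrimePower q → gcd q 6 ≡ 1 →
    -- (a) F₁ permutes F_{q²}, for every field K with q² elements
    ((K : Field c) → HasSize K (q ℕ.* q) →
      PermutesOn (Univ K) (F₁ K q))
    ×
    -- (b) for every field F with q elements and nonsquare ν ∈ F,
    --     x ↦ x(x²-9ν)/(x²-ν) is well defined and permutes F
    ((F : Field c) → HasSize F q → (ν : Field.Carrier F) → ¬ IsSquare F ν →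
      ((x : Field.Carrier F) → ¬ (hDen F ν x ≡ Field.0# F)) ×
      PermutesOn (Univ F) (h F ν))
    ×
    -- (c) g is well defined on μ_{q+1} ⊆ F_{q²}* and permutes μ_{q+1}
    ((K : Field c) → HasSize K (q ℕ.* q) →
      ((x : Field.Carrier K) → μ K (suc q) x → ¬ (gDen K x ≡ Field.0# K)) ×
      PermutesOn (μ K (suc q)) (g K))
theorem3p1 {c} q (p , k , p-prime , _ , q≡p^k) gcd[q,6]≡1 =
  (λ K size → let open Setting K size in
    FiniteField.injective⇒permutes K size F (F-injective 3≢0)) ,
  (λ F size ν ν-nonsquare → let open RationalFunctionH F ν-nonsquare in
    hDen≢0 , FiniteField.injective⇒permutes F size (h F ν) h-injective) ,
  (λ K size → let open Setting K size in
    (λ _ → gDen≢0 3≢0) , (λ _ → g-μ 3≢0) , (λ _ _ → g-injective 3≢0) , (λ _ → g-surjective 3≢0 size))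
  where
  module Setting (K : Field c) (size : HasSize K (q ℕ.* q)) where
    open SquareOrderField K {k = k} p-prime q≡p^k size public
    open Conjugation.Involution K q σ-+ σ-involutive public
    3≢0 : ¬ (Field.⟦ K ⟧ 3 ≡ Field.0# K)
    3≢0 = FieldArithmetic.⟦3⟧≢0 K q ⟦q⟧≡0 (gcd[n,6]≡1⇒3∤n gcd[q,6]≡1)
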